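{- Let $\Sigma$ be a finite alphabet with $\sigma=|\Sigma|$, $k\in\mathbb{N}$, and let $w\in\Sigma^{\ast}$ with $|\operatorname{ScatFact}_k(w)|=\sigma^k-1$. Let $i\in\{1,\dots,k-1\}$ and $\alpha,\beta\in\Sigma^{\ast}$ such that $\alpha[|\alpha|]=\operatorname{m}(w)[i]$, $\operatorname{alph}(\alpha[1..|\alpha|-1])=\operatorname{alph}(\operatorname{inner}_i(w))$, $\operatorname{inner}_i(w)\in\operatorname{ScatFact}(\alpha[1..|\alpha|-1])$, $|\operatorname{r}(w)|\le|\beta|$ and $\operatorname{alph}(\beta)=\operatorname{alph}(\operatorname{r}(w))$. Then $w'=\operatorname{ar}_1(w)\cdots\operatorname{ar}_{i-1}(w)\,\alpha\,\operatorname{ar}_{i+1}(w)\cdots\operatorname{ar}_{k-1}(w)\,\beta$ satisfies $|\operatorname{ScatFact}_k(w')|=\sigma^k-1$.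
   Context: $\operatorname{alph}(w)$ is the set of letters of $w$; $\operatorname{ScatFact}(w)$ is the set of all scattered factors (subsequences) of $w$ and $\operatorname{ScatFact}_k(w)$ those of length $k$; $v[i]$ is the $i$-th letter and $v[i..j]$ the factor from position $i$ to $j$. Arch factorisation: $w=\operatorname{ar}_1(w)\cdots\operatorname{ar}_{\iota(w)}(w)\operatorname{r}(w)$ where $\operatorname{ar}_1(w)$ is the shortest prefix containing all letters of $\Sigma$, each subsequent arch is the shortest prefix of the remaining suffix containing all letters of $\Sigma$, and the rest $\operatorname{r}(w)$ does not contain all letters of $\Sigma$ (for the $w$ here, $\iota(w)=k-1$). The modus $\operatorname{m}(w)$ is the concatenation of the last letters of the arches; $\operatorname{inner}_i(w)$ denotes the arch $\operatorname{ar}_i(w)$ without its last letter. -}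

module Defs where

open import Data.Nat using (ℕ; zero; suc; _∸_)
open import Data.Fin using (Fin)
open import Data.Fin.Properties using (_≟_)
open import Data.List using (List; []; _∷_; _++_; map; concat; concatMap; filter; length; reverse; take; drop; last; allFin)
open import Data.List.Relation.Unary.All using (all?)
import Data.List.Membership.DecPropositional as MemDec
open import Data.List.Membership.Propositional using (_∈_)
open import Data.List.Relation.Binary.Sublist.Propositional using (_⊆_)
import Data.List.Relation.Binary.Sublist.DecPropositional as SubDec
open import Data.Maybe using (Maybe; just; nothing)
open import Data.Product using (_×_; _,_; proj₁; proj₂)
open import Relation.Nullary using (yes; no)
open import Function.Bundles using (_⇔_)

Word : ℕ → Set
Word σ = List (Fin σ)

SameAlph : ∀ {σ} → Word σ → Word σ → Set
SameAlph x y = ∀ a → (a ∈ x) ⇔ (a ∈ y)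

-- all words of length k over Σ (each exactly once)
allWords : (σ : ℕ) → ℕ → List (Word σ)
allWords σ zero = [] ∷ []
allWords σ (suc k) = concatMap (λ a → map (a ∷_) (allWords σ k)) (allFin σ)

numScatFact : ∀ {σ} → ℕ → Word σ → ℕ
numScatFact {σ} k w = length (filter (λ u → SubDec._⊆?_ (_≟_ {σ}) u w) (allWords σ k))

IsScatFact : ∀ {σ} → Word σ → Word σ → Set
IsScatFact u v = u ⊆ v

dropLast : ∀ {A : Set} → List A → List A
dropLast [] = []
dropLast (x ∷ []) = []
dropLast (x ∷ y ∷ xs) = x ∷ dropLast (y ∷ xs)

-- shortest prefix containing all letters of Σ, split off; nothing if w
-- does not contain all letters.  (acc = reversed part already read)
splitArchAux : ∀ {σ} → Word σ → Word σ → Maybe (Word σ × Word σ)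
splitArchAux acc [] = nothing
splitArchAux {σ} acc (x ∷ xs) with all? (λ a → MemDec._∈?_ (_≟_ {σ}) a (x ∷ acc)) (allFin σ)
... | yes _ = just (reverse (x ∷ acc) , xs)
... | no _  = splitArchAux (x ∷ acc) xs

splitArch : ∀ {σ} → Word σ → Maybe (Word σ × Word σ)
splitArch w = splitArchAux [] w

archFactAux : ∀ {σ} → ℕ → Word σ → List (Word σ) × Word σ
archFactAux zero w = [] , w
archFactAux (suc f) w with splitArch w
... | nothing = [] , w
... | just (a , r) with archFactAux f r
...   | (as , rest) = (a ∷ as) , rest

archFact : ∀ {σ} → Word σ → List (Word σ) × Word σ
archFact w = archFactAux (length w) w

arches : ∀ {σ} → Word σ → List (Word σ)
arches w = proj₁ (archFact w)

rest : ∀ {σ} → Word σ → Word σ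
rest w = proj₂ (archFact w)

-- ar_i(w), 1-based; [] if i is out of range
ar : ∀ {σ} → ℕ → Word σ → Word σ
ar i w = concat (take 1 (drop (i ∸ 1) (arches w)))

inner : ∀ {σ} → ℕ → Word σ → Word σ
inner i w = dropLast (ar i w)

modusAt : ∀ {σ} → ℕ → Word σ → Maybe (Fin σ)
modusAt i w = last (ar i w)

replaceArch : ∀ {σ} → ℕ → ℕ → Word σ → Word σ → Word σ → Word σ
replaceArch k i w α β =
  concat (take (i ∸ 1) (arches w)) ++ α ++
  concat (drop i (take (k ∸ 1) (arches w))) ++ β

-- Write w = ar₁ ⋯ arₙ r and pick a letter a ∉ alph(r). Every word of length ≤ n
-- embeds into the arches, so n < k; write k = n + 1 + d. In an embedding of m(w) v
-- into w the letters of m(w) use up all the arches, so v embeds into r; hence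
-- m(w) a^{d+1} is not a scattered factor of w, and if d ≥ 1 and b occurs in r, neither
-- is m(w) a b a^{d-1}. So σ^k − 1 scattered factors force r = ε or d = 0. Replacing
-- the inner part of an arch by a superword with the same alphabet yields again an
-- arch with the same last letter. Hence every u ∈ ScatFact_k(w) survives in w': if
-- its embedding stays inside the arches it embeds into the new arches; otherwise
-- d = 0, the first n letters of u embed into the n arches of w' and its last letter
-- lies in alph(r) = alph(β). Conversely, m(w') a^{d+1} is still missing from w'.
module Submission where

open import Defs
open import Data.Nat using (ℕ; zero; suc; _+_; _*_; _^_; _≤_; _<_; z≤n; s≤s)
open import Data.Nat.Properties
  using (≤-refl; ≤-trans; ≤-reflexive; ≤-antisym; ≤-pred; ≰⇒>; m≤n⇒m≤1+n; +-comm;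
         +-identityʳ; +-monoˡ-≤; m+1+n≢m; m+1+n≢0; 1+n≰n; m≤n⇒∃[o]m+o≡n)
open import Data.Fin using (Fin; zero)
open import Data.Fin.Properties using (_≟_)
open import Data.List
  using (List; []; _∷_; _++_; [_]; map; concat; concatMap; filter; length; allFin; reverse;
         replicate; take; drop; last; initLast; _∷ʳ′_)
open import Data.List.Properties
  using (length-++; length-map; length-tabulate; length-replicate; ++-assoc; ++-identityʳ;
         ++-cancelˡ; ∷-injectiveˡ; ∷-injectiveʳ; concat-++; unfold-reverse; take-all;
         take++drop≡id; filter-all; filter-notAll)
open import Data.List.Membership.Propositional using (_∈_; _∉_; lose)
open import Data.List.Membership.Propositional.Properties
  using (∈-allFin; ∈-concatMap⁺; ∈-concatMap⁻; ∈-map⁺; ∈-map⁻; ∈-++⁺ˡ; ∈-++⁺ʳ; ∈-++⁻)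
import Data.List.Membership.DecPropositional as MemDec
open import Data.List.Relation.Unary.Any using (here; there; satisfied)
open import Data.List.Relation.Unary.Any.Properties using (reverse⁺; reverse⁻)
open import Data.List.Relation.Unary.All as All using (All; []; _∷_; all?)
open import Data.List.Relation.Unary.All.Properties using (tabulate⁺; tabulate⁻)
import Data.List.Relation.Unary.All.Properties as AllP
open import Data.List.Relation.Unary.All.Properties.Core using (¬All⇒Any¬)
open import Data.List.Relation.Binary.Sublist.Propositional
  using (_⊆_; []; _∷_; _∷ʳ_; minimum; ⊆-refl; ⊆-trans; from∈; to∈)
open import Data.List.Relation.Binary.Sublist.Propositional.Properties using (∷ˡ⁻; ++⁺; ++⁺ʳ; ++⁺ˡ)
import Data.List.Relation.Binary.Sublist.DecPropositional as SubDec
open import Data.Maybe using (just; nothing)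
open import Data.Maybe.Properties using (just-injective)
open import Data.Product using (∃; ∃₂; ∃-syntax; _×_; _,_; proj₁; proj₂; map₂)
open import Data.Sum using (_⊎_; inj₁; inj₂)
import Data.Sum as Sum
open import Data.Empty using (⊥-elim)
open import Function using (_∘_; id; case_of_)
open import Function.Bundles using (Equivalence)
open import Relation.Nullary using (¬_; yes; no; contradiction)
open import Relation.Unary using (Pred; Decidable)
open import Relation.Binary.PropositionalEquality
  using (_≡_; _≢_; refl; sym; trans; cong; cong₂; subst; subst₂; module ≡-Reasoning)

open ≡-Reasoning

module _ {a p} {A : Set a} {P Q : Pred A p} (P? : Decidable P) (Q? : Decidable Q) where

  length-filter-mono : ∀ xs → (∀ {x} → x ∈ xs → P x → Q x) →
                       length (filter P? xs) ≤ length (filter Q? xs)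
  length-filter-mono []       P⇒Q = z≤n
  length-filter-mono (x ∷ xs) P⇒Q with P? x | Q? x
  ... | yes _  | yes _  = s≤s (length-filter-mono xs (λ x∈ → P⇒Q (there x∈)))
  ... | yes px | no ¬qx = contradiction (P⇒Q (here refl) px) ¬qx
  ... | no _   | yes _  = m≤n⇒m≤1+n (length-filter-mono xs (λ x∈ → P⇒Q (there x∈)))
  ... | no _   | no _   = length-filter-mono xs (λ x∈ → P⇒Q (there x∈))

module _ {a p} {A : Set a} {P : Pred A p} (P? : Decidable P) where

  length-filter-reject₂ : ∀ xs {y z} → y ∈ xs → z ∈ xs → y ≢ z → ¬ P y → ¬ P z →
                          2 + length (filter P? xs) ≤ length xs
  length-filter-reject₂ (x ∷ xs) (here refl) (here refl) y≢z _ _ = contradiction refl y≢z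
  length-filter-reject₂ (x ∷ xs) (here refl) (there z∈) _ ¬py ¬pz with P? x
  ... | yes py = contradiction py ¬py
  ... | no _   = s≤s (filter-notAll P? xs (lose z∈ ¬pz))
  length-filter-reject₂ (x ∷ xs) (there y∈) (here refl) _ ¬py ¬pz with P? x
  ... | yes pz = contradiction pz ¬pz
  ... | no _   = s≤s (filter-notAll P? xs (lose y∈ ¬py))
  length-filter-reject₂ (x ∷ xs) (there y∈) (there z∈) y≢z ¬py ¬pz with P? x
  ... | yes _ = s≤s (length-filter-reject₂ xs y∈ z∈ y≢z ¬py ¬pz)
  ... | no _  = m≤n⇒m≤1+n (length-filter-reject₂ xs y∈ z∈ y≢z ¬py ¬pz)

length-concatMap-const : ∀ {a b} {A : Set a} {B : Set b} (f : A → List B) {m} →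
                         (∀ x → length (f x) ≡ m) → ∀ xs → length (concatMap f xs) ≡ length xs * m
length-concatMap-const f len []       = refl
length-concatMap-const f len (x ∷ xs) =
  trans (length-++ (f x)) (cong₂ _+_ (len x) (length-concatMap-const f len xs))

module _ {a} {A : Set a} where

  c∷u⊆X++c∷Z⇒u⊆Z : ∀ (X : List A) {c u Z} → c ∉ X → c ∷ u ⊆ X ++ c ∷ Z → u ⊆ Z
  c∷u⊆X++c∷Z⇒u⊆Z []      c∉X (_ ∷ʳ p)    = ∷ˡ⁻ p
  c∷u⊆X++c∷Z⇒u⊆Z []      c∉X (refl ∷ p)  = p
  c∷u⊆X++c∷Z⇒u⊆Z (x ∷ X) c∉X (_ ∷ʳ p)    = c∷u⊆X++c∷Z⇒u⊆Z X (c∉X ∘ there) p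
  c∷u⊆X++c∷Z⇒u⊆Z (x ∷ X) c∉X (refl ∷ p)  = contradiction (here refl) c∉X

  u∷ʳx⊆X++Z⇒⊆X⊎∈Z : ∀ (X : List A) {u x Z} → u ++ [ x ] ⊆ X ++ Z → u ++ [ x ] ⊆ X ⊎ x ∈ Z
  u∷ʳx⊆X++Z⇒⊆X⊎∈Z []      {u} p                = inj₂ (to∈ (⊆-trans (++⁺ˡ u ⊆-refl) p))
  u∷ʳx⊆X++Z⇒⊆X⊎∈Z (y ∷ X) {[]}    (_ ∷ʳ p)    = Sum.map₁ (y ∷ʳ_) (u∷ʳx⊆X++Z⇒⊆X⊎∈Z X {[]} p)
  u∷ʳx⊆X++Z⇒⊆X⊎∈Z (y ∷ X) {_ ∷ u} (_ ∷ʳ p)    = Sum.map₁ (y ∷ʳ_) (u∷ʳx⊆X++Z⇒⊆X⊎∈Z X {_ ∷ u} p)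
  u∷ʳx⊆X++Z⇒⊆X⊎∈Z (y ∷ X) {[]}    (refl ∷ p) = inj₁ (refl ∷ minimum X)
  u∷ʳx⊆X++Z⇒⊆X⊎∈Z (y ∷ X) {_ ∷ u} (refl ∷ p) = Sum.map₁ (refl ∷_) (u∷ʳx⊆X++Z⇒⊆X⊎∈Z X {u} p)

  concat-++-∷ : ∀ xss {ys : List A} {yss zs} →
                concat (xss ++ ys ∷ yss) ++ zs ≡ concat xss ++ ys ++ concat yss ++ zs
  concat-++-∷ xss {ys} {yss} {zs} = begin
    concat (xss ++ ys ∷ yss) ++ zs         ≡⟨ cong (_++ zs) (concat-++ xss (ys ∷ yss)) ⟨
    (concat xss ++ ys ++ concat yss) ++ zs ≡⟨ ++-assoc (concat xss) (ys ++ concat yss) zs ⟩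
    concat xss ++ (ys ++ concat yss) ++ zs ≡⟨ cong (concat xss ++_) (++-assoc ys (concat yss) zs) ⟩
    concat xss ++ ys ++ concat yss ++ zs   ∎

  drop-suc : ∀ n (xs : List A) → drop (suc n) xs ≡ drop 1 (drop n xs)
  drop-suc zero    xs       = refl
  drop-suc (suc n) []       = refl
  drop-suc (suc n) (x ∷ xs) = drop-suc n xs

  last-∷ʳ : ∀ (xs : List A) {x} → last (xs ++ [ x ]) ≡ just x
  last-∷ʳ []           = refl
  last-∷ʳ (y ∷ [])     = refl
  last-∷ʳ (y ∷ z ∷ xs) = last-∷ʳ (z ∷ xs)

module _ {A : Set} where

  dropLast-∷ʳ : ∀ (xs : List A) {x} → dropLast (xs ++ [ x ]) ≡ xs
  dropLast-∷ʳ []           = refl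
  dropLast-∷ʳ (y ∷ [])     = refl
  dropLast-∷ʳ (y ∷ z ∷ xs) = cong (y ∷_) (dropLast-∷ʳ (z ∷ xs))

  dropLast-++-last : ∀ (xs : List A) {x} → last xs ≡ just x → dropLast xs ++ [ x ] ≡ xs
  dropLast-++-last (y ∷ [])     refl = refl
  dropLast-++-last (y ∷ z ∷ xs) eq   = cong (y ∷_) (dropLast-++-last (z ∷ xs) eq)

reverse-∷-++ : ∀ {a} {A : Set a} (x : A) acc l → reverse acc ++ x ∷ l ≡ reverse (x ∷ acc) ++ l
reverse-∷-++ x acc l = begin
  reverse acc ++ x ∷ l       ≡⟨ ++-assoc (reverse acc) [ x ] l ⟨
  (reverse acc ++ [ x ]) ++ l ≡⟨ cong (_++ l) (unfold-reverse x acc) ⟨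
  reverse (x ∷ acc) ++ l     ∎

length-allWords : ∀ σ k → length (allWords σ k) ≡ σ ^ k
length-allWords σ zero    = refl
length-allWords σ (suc k) = begin
  length (concatMap (λ a → map (a ∷_) (allWords σ k)) (allFin σ))
    ≡⟨ length-concatMap-const (λ a → map (a ∷_) (allWords σ k))
         (λ a → trans (length-map (a ∷_) (allWords σ k)) (length-allWords σ k)) (allFin σ) ⟩
  length (allFin σ) * σ ^ k
    ≡⟨ cong (_* σ ^ k) (length-tabulate {n = σ} id) ⟩
  σ * σ ^ k ∎

∈-allWords⁻ : ∀ {σ} k {u : Word σ} → u ∈ allWords σ k → length u ≡ k
∈-allWords⁻         zero    (here refl) = refl
∈-allWords⁻ {σ = σ} (suc k) u∈
  with a , u∈a∷ ← satisfied (∈-concatMap⁻ (λ a → map (a ∷_) (allWords σ k)) {xs = allFin σ} u∈)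
  with v , v∈ , refl ← ∈-map⁻ (a ∷_) u∈a∷
  = cong suc (∈-allWords⁻ k v∈)

∈-allWords⁺ : ∀ {σ k} (u : Word σ) → length u ≡ k → u ∈ allWords σ k
∈-allWords⁺         []      refl = here refl
∈-allWords⁺ {σ = σ} (a ∷ u) refl =
  ∈-concatMap⁺ (λ b → map (b ∷_) (allWords σ (length u))) {xs = allFin σ}
    (lose (∈-allFin a) (∈-map⁺ (a ∷_) (∈-allWords⁺ u refl)))

isScatFact? : ∀ {σ} (w : Word σ) → Decidable (λ u → IsScatFact u w)
isScatFact? w u = SubDec._⊆?_ _≟_ u w

module _ {σ : ℕ} (k : ℕ) where

  numScatFact-mono : ∀ {w w' : Word σ} → (∀ {u} → length u ≡ k → u ⊆ w → u ⊆ w') →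
                     numScatFact k w ≤ numScatFact k w'
  numScatFact-mono {w} {w'} keep =
    length-filter-mono (isScatFact? w) (isScatFact? w') (allWords σ k) (keep ∘ ∈-allWords⁻ k)

  numScatFact-all : ∀ {w : Word σ} → (∀ {u} → length u ≡ k → u ⊆ w) → numScatFact k w ≡ σ ^ k
  numScatFact-all {w} all-in = trans
    (cong length (filter-all (isScatFact? w) (All.tabulate (all-in ∘ ∈-allWords⁻ k))))
    (length-allWords σ k)

  numScatFact-missing : ∀ {w y : Word σ} → length y ≡ k → ¬ y ⊆ w → numScatFact k w < σ ^ k
  numScatFact-missing {w} {y} len y⊈w = subst (numScatFact k w <_) (length-allWords σ k)
    (filter-notAll (isScatFact? w) (allWords σ k) (lose (∈-allWords⁺ y len) y⊈w))

  numScatFact-missing₂ : ∀ {w y z : Word σ} → length y ≡ k → length z ≡ k → y ≢ z →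
                         ¬ y ⊆ w → ¬ z ⊆ w → 2 + numScatFact k w ≤ σ ^ k
  numScatFact-missing₂ {w} {y} {z} leny lenz y≢z y⊈w z⊈w =
    subst (2 + numScatFact k w ≤_) (length-allWords σ k)
      (length-filter-reject₂ (isScatFact? w) (allWords σ k)
        (∈-allWords⁺ y leny) (∈-allWords⁺ z lenz) y≢z y⊈w z⊈w)

module _ {σ : ℕ} where

  Full : Word σ → Set
  Full W = ∀ b → b ∈ W

  -- The last letter of an arch is the first occurrence of that letter: this is
  -- what "shortest prefix containing all letters" amounts to.
  data Arch : Word σ → Set where
    arch : ∀ {X c} → c ∉ X → Full (X ++ [ c ]) → Arch (X ++ [ c ])

  ¬Full⇒∃∉ : ∀ {W} → ¬ Full W → ∃ λ a → a ∉ W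
  ¬Full⇒∃∉ {W} ¬full =
    satisfied (¬All⇒Any¬ (λ b → MemDec._∈?_ _≟_ b W) (allFin σ) (¬full ∘ tabulate⁻))

  Arch⇒nonEmpty : ∀ {X} → Arch X → 0 < length X
  Arch⇒nonEmpty (arch {X} {c} _ _) = subst (0 <_) (sym (length-++ X)) (+-monoˡ-≤ 1 z≤n)

  arch-widen : ∀ {X α c} → c ∉ X → Full (X ++ [ c ]) → SameAlph α X → Arch (α ++ [ c ])
  arch-widen {X} {α} {c} c∉X full sameAlph = arch (c∉X ∘ Equivalence.to (sameAlph c)) fullα
    where
    fullα : Full (α ++ [ c ])
    fullα b with ∈-++⁻ X (full b)
    ... | inj₁ b∈X = ∈-++⁺ˡ (Equivalence.from (sameAlph b) b∈X)
    ... | inj₂ b≡c = ∈-++⁺ʳ α b≡c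

  ⊆-concat-arches : ∀ {as u} → All Arch as → length u ≤ length as → u ⊆ concat as
  ⊆-concat-arches {u = []}    _                    _         = minimum _
  ⊆-concat-arches {u = b ∷ u} (arch _ full ∷ arches) (s≤s len) =
    ++⁺ (from∈ (full b)) (⊆-concat-arches arches len)

  modus : ∀ {as} → All Arch as → Word σ
  modus []                     = []
  modus (arch {c = c} _ _ ∷ arches) = c ∷ modus arches

  length-modus-∷ : ∀ {as} (arches : All Arch as) a t →
                   length (modus arches ++ a ∷ t) ≡ suc (length as + length t)
  length-modus-∷ []                 a t = refl
  length-modus-∷ (arch _ _ ∷ arches) a t = cong suc (length-modus-∷ arches a t)

  modus-++-⊆⁻ : ∀ {as u Z} (arches : All Arch as) → modus arches ++ u ⊆ concat as ++ Z → u ⊆ Z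
  modus-++-⊆⁻                 []                        p = p
  modus-++-⊆⁻ {_ ∷ as} {u} {Z} (arch {X} {c} c∉X _ ∷ arches) p =
    modus-++-⊆⁻ arches (c∷u⊆X++c∷Z⇒u⊆Z X c∉X (subst (c ∷ modus arches ++ u ⊆_) reassoc p))
    where
    reassoc : ((X ++ [ c ]) ++ concat as) ++ Z ≡ X ++ c ∷ concat as ++ Z
    reassoc = trans (++-assoc (X ++ [ c ]) (concat as) Z) (++-assoc X [ c ] (concat as ++ Z))

  modus-∷-⊈ : ∀ {as a t Z} (arches : All Arch as) → a ∉ Z →
              ¬ (modus arches ++ a ∷ t ⊆ concat as ++ Z)
  modus-∷-⊈ arches a∉Z = a∉Z ∘ to∈ ∘ modus-++-⊆⁻ arches

  ⊆-replaceArches : ∀ {as as' : List (Word σ)} {r β u : Word σ} →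
                    All Arch as' → concat as ⊆ concat as' → SameAlph β r →
                    r ≡ [] ⊎ length u ≤ suc (length as') → u ⊆ concat as ++ r → u ⊆ concat as' ++ β
  ⊆-replaceArches {β = β} _ sub _ (inj₁ refl) u⊆ =
    ++⁺ʳ β (⊆-trans (subst (_ ⊆_) (++-identityʳ _) u⊆) sub)
  ⊆-replaceArches {as} {as'} {β = β} {u} arches' sub sameβ (inj₂ len) u⊆ with initLast u
  ... | []       = minimum _
  ... | v ∷ʳ′ x with u∷ʳx⊆X++Z⇒⊆X⊎∈Z (concat as) u⊆
  ...   | inj₁ u⊆arches = ++⁺ʳ β (⊆-trans u⊆arches sub)
  ...   | inj₂ x∈r      =
    ++⁺ (⊆-concat-arches arches' len-v) (from∈ (Equivalence.from (sameβ x) x∈r))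
    where
    len-v : length v ≤ length as'
    len-v = ≤-pred (subst (_≤ suc (length as')) (trans (length-++ v) (+-comm _ 1)) len)

module _ {σ : ℕ} where

  splitArchAux-just : ∀ (acc l : Word σ) {a r} → splitArchAux acc l ≡ just (a , r) → ¬ Full acc →
                      Arch a × reverse acc ++ l ≡ a ++ r
  splitArchAux-just acc (x ∷ l) eq ¬full with all? (λ a → MemDec._∈?_ (_≟_ {σ}) a (x ∷ acc)) (allFin σ)
  splitArchAux-just acc (x ∷ l) refl ¬full | yes all∈ =
    subst Arch (sym (unfold-reverse x acc)) (arch x∉ full) , reverse-∷-++ x acc l
    where
    x∉ : x ∉ reverse acc
    x∉ x∈ = ¬full λ b → case tabulate⁻ all∈ b of λ where
      (here refl) → reverse⁻ x∈
      (there b∈)  → b∈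
    full : Full (reverse acc ++ [ x ])
    full b = subst (b ∈_) (unfold-reverse x acc) (reverse⁺ (tabulate⁻ all∈ b))
  ... | no ¬all∈ =
    map₂ (trans (reverse-∷-++ x acc l)) (splitArchAux-just (x ∷ acc) l eq (¬all∈ ∘ tabulate⁺))

  splitArchAux-nothing : ∀ (acc l : Word σ) → splitArchAux acc l ≡ nothing → ¬ Full acc →
                         ¬ Full (reverse acc ++ l)
  splitArchAux-nothing acc []      _  ¬full full =
    ¬full λ b → reverse⁻ (subst (b ∈_) (++-identityʳ (reverse acc)) (full b))
  splitArchAux-nothing acc (x ∷ l) eq ¬full with all? (λ a → MemDec._∈?_ (_≟_ {σ}) a (x ∷ acc)) (allFin σ)
  splitArchAux-nothing acc (x ∷ l) () ¬full | yes _
  ... | no ¬all∈ = subst (¬_ ∘ Full) (sym (reverse-∷-++ x acc l))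
    (splitArchAux-nothing (x ∷ acc) l eq (¬all∈ ∘ tabulate⁺))

  record IsArchFactorisation (w : Word σ) (fact : List (Word σ) × Word σ) : Set where
    field
      concat-arches-rest : concat (proj₁ fact) ++ proj₂ fact ≡ w
      all-arch           : All Arch (proj₁ fact)
      rest-notFull       : ¬ Full (proj₂ fact)

  open IsArchFactorisation

  archFactAux-sound : ∀ fuel (w : Word σ) → length w ≤ fuel → ¬ Full {σ} [] →
                      IsArchFactorisation w (archFactAux fuel w)
  archFactAux-sound zero [] _ ¬full[] = record
    { concat-arches-rest = refl ; all-arch = [] ; rest-notFull = ¬full[] }
  archFactAux-sound (suc fuel) w len ¬full[] with splitArch w in eq
  ... | nothing = record
    { concat-arches-rest = refl
    ; all-arch           = []
    ; rest-notFull       = splitArchAux-nothing [] w eq ¬full[]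
    }
  ... | just (a , r) with splitArchAux-just [] w eq ¬full[]
  ... | arch-a , w≡a++r with archFactAux fuel r | archFactAux-sound fuel r
    (≤-pred (≤-trans (+-monoˡ-≤ (length r) (Arch⇒nonEmpty arch-a))
                     (subst (_≤ suc fuel) (trans (cong length w≡a++r) (length-++ a)) len))) ¬full[]
  ... | as , r' | ih = record
    { concat-arches-rest = trans (++-assoc a (concat as) r')
                                 (trans (cong (a ++_) (concat-arches-rest ih)) (sym w≡a++r))
    ; all-arch           = arch-a ∷ all-arch ih
    ; rest-notFull       = rest-notFull ih
    }

archFact-sound : ∀ {s} (w : Word (suc s)) → IsArchFactorisation w (archFact w)
archFact-sound w = archFactAux-sound (length w) w ≤-refl (λ full → case full zero of λ ())

module _ {σ : ℕ} (k : ℕ) where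

  fewerArches : ∀ {as r} → All Arch as → numScatFact k (concat as ++ r) + 1 ≡ σ ^ k → length as < k
  fewerArches {as} {r} arches count = ≰⇒> λ k≤n → m+1+n≢m (σ ^ k)
    (trans (cong (_+ 1) (sym (numScatFact-all k λ len →
      ++⁺ʳ r (⊆-concat-arches arches (≤-trans (≤-reflexive len) k≤n))))) count)

  rest-empty : ∀ {as r a e} (arches : All Arch as) → a ∉ r → suc (length as) + suc e ≡ k →
               numScatFact k (concat as ++ r) + 1 ≡ σ ^ k → r ≡ []
  rest-empty {r = []}                _      _   _   _     = refl
  rest-empty {as} {b ∷ r} {a} {e} arches a∉r len count =
    contradiction (≤-pred (subst (2 + N ≤_) (trans (sym count) (+-comm N 1)) twoMissing)) 1+n≰n
    where
    N : ℕ
    N = numScatFact k (concat as ++ b ∷ r)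
    witness : Fin σ → Word σ
    witness x = modus arches ++ a ∷ x ∷ replicate e a
    length-witness : ∀ x → length (witness x) ≡ k
    length-witness x = trans (length-modus-∷ arches a (x ∷ replicate e a))
      (trans (cong (λ l → suc (length as + suc l)) (length-replicate e)) len)
    witness-injective : witness a ≢ witness b
    witness-injective eq = a∉r (here (∷-injectiveˡ (∷-injectiveʳ (++-cancelˡ (modus arches) _ _ eq))))
    twoMissing : 2 + N ≤ σ ^ k
    twoMissing = numScatFact-missing₂ k (length-witness a) (length-witness b) witness-injective
      (modus-∷-⊈ arches a∉r) (modus-∷-⊈ arches a∉r)

  rest-empty⊎short : ∀ {as r a} d (arches : All Arch as) → a ∉ r → suc (length as) + d ≡ k →
                    numScatFact k (concat as ++ r) + 1 ≡ σ ^ k → r ≡ [] ⊎ k ≤ suc (length as)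
  rest-empty⊎short zero    _      _   len _     =
    inj₂ (≤-reflexive (trans (sym len) (cong suc (+-identityʳ _))))
  rest-empty⊎short (suc e) arches a∉r len count = inj₁ (rest-empty arches a∉r len count)

  numScatFact-replaceArches : ∀ {as as' : List (Word σ)} {r β : Word σ} →
    All Arch as → All Arch as' → length as' ≡ length as → concat as ⊆ concat as' →
    ¬ Full r → SameAlph β r →
    numScatFact k (concat as ++ r) + 1 ≡ σ ^ k → numScatFact k (concat as' ++ β) + 1 ≡ σ ^ k
  numScatFact-replaceArches {as} {as'} {r} {β} arches arches' len sub ¬full sameβ count
    with a , a∉r ← ¬Full⇒∃∉ ¬full
    with d , len-k ← m≤n⇒∃[o]m+o≡n (fewerArches arches count)
    = ≤-antisym upper (subst (_≤ N' + 1) count (+-monoˡ-≤ 1 lower))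
    where
    N' : ℕ
    N' = numScatFact k (concat as' ++ β)
    length-missing : length (modus arches' ++ a ∷ replicate d a) ≡ k
    length-missing = trans (length-modus-∷ arches' a (replicate d a))
      (trans (cong₂ (λ n l → suc (n + l)) len (length-replicate d)) len-k)
    upper : N' + 1 ≤ σ ^ k
    upper = subst (_≤ σ ^ k) (+-comm 1 N')
      (numScatFact-missing k length-missing (modus-∷-⊈ arches' (a∉r ∘ Equivalence.to (sameβ a))))
    lower : numScatFact k (concat as ++ r) ≤ N'
    lower = numScatFact-mono k λ len-u → ⊆-replaceArches {as = as} arches' sub sameβ
      (Sum.map₂ (λ k≤ → ≤-trans (≤-reflexive len-u) (subst (λ n → k ≤ suc n) (sym len) k≤))
                (rest-empty⊎short d arches a∉r len-k count))

  numScatFact-widenArch : ∀ {pre post : List (Word σ)} {X α r β : Word σ} {c} →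
    All Arch pre → All Arch post → c ∉ X → Full (X ++ [ c ]) → SameAlph α X → X ⊆ α →
    ¬ Full r → SameAlph β r →
    numScatFact k (concat (pre ++ (X ++ [ c ]) ∷ post) ++ r) + 1 ≡ σ ^ k →
    numScatFact k (concat (pre ++ (α ++ [ c ]) ∷ post) ++ β) + 1 ≡ σ ^ k
  numScatFact-widenArch {pre} {post} {X} {α} {c = c} arches-pre arches-post c∉X full sameα X⊆α =
    numScatFact-replaceArches
      (AllP.++⁺ arches-pre (arch c∉X full ∷ arches-post))
      (AllP.++⁺ arches-pre (arch-widen c∉X full sameα ∷ arches-post))
      (trans (length-++ pre) (sym (length-++ pre)))
      (subst₂ _⊆_ (concat-++ pre ((X ++ [ c ]) ∷ post)) (concat-++ pre ((α ++ [ c ]) ∷ post))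
        (++⁺ (⊆-refl {x = concat pre})
             (++⁺ (++⁺ X⊆α (⊆-refl {x = [ c ]})) (⊆-refl {x = concat post}))))

module _ {σ : ℕ} where

  arch-head : ∀ {ys : List (Word σ)} {c} → All Arch ys → last (concat (take 1 ys)) ≡ just c →
    ∃₂ λ X post → ys ≡ (X ++ [ c ]) ∷ post × c ∉ X × Full (X ++ [ c ]) × All Arch post
  arch-head (arch {X} {c'} c'∉X full ∷ arches) last≡c
    with refl ← just-injective
                  (trans (sym (trans (cong last (++-identityʳ (X ++ [ c' ]))) (last-∷ʳ X))) last≡c)
    = X , _ , refl , c'∉X , full , arches

  inner-≡ : ∀ i (w : Word σ) {X c post} → drop i (arches w) ≡ (X ++ [ c ]) ∷ post →
            inner (suc i) w ≡ X
  inner-≡ i w {X} dropᵢ = trans (cong (dropLast ∘ concat ∘ take 1) dropᵢ)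
                                (trans (cong dropLast (++-identityʳ _)) (dropLast-∷ʳ X))

  replaceArch-≡ : ∀ k i (w : Word σ) {α β X post} →
                  length (arches w) ≤ k → drop i (arches w) ≡ X ∷ post →
                  replaceArch (suc k) (suc i) w α β ≡ concat (take i (arches w)) ++ α ++ concat post ++ β
  replaceArch-≡ k i w {α} {β} {X} {post} n≤k dropᵢ =
    cong (λ suffix → concat (take i (arches w)) ++ α ++ concat suffix ++ β) (begin
      drop (suc i) (take k (arches w)) ≡⟨ cong (drop (suc i)) (take-all k (arches w) n≤k) ⟩
      drop (suc i) (arches w)          ≡⟨ drop-suc i (arches w) ⟩
      drop 1 (drop i (arches w))       ≡⟨ cong (drop 1) dropᵢ ⟩
      post                             ∎)

mainTheorem9 : (σ k : ℕ) (w : Word σ) →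
    numScatFact k w + 1 ≡ σ ^ k →
    (i : ℕ) → 1 ≤ i → i < k →
    (α β : Word σ) →
    ∃[ c ] (last α ≡ just c × modusAt i w ≡ just c) →
    SameAlph (dropLast α) (inner i w) →
    IsScatFact (inner i w) (dropLast α) →
    length (rest w) ≤ length β →
    SameAlph β (rest w) →
    numScatFact k (replaceArch k i w α β) + 1 ≡ σ ^ k
mainTheorem9 σ       k       w count zero    ()
mainTheorem9 σ       zero    w count (suc i) _  ()
mainTheorem9 zero    (suc k) w count (suc i) _  _ _ _ _ _ _ _ _ =
  ⊥-elim (m+1+n≢0 (numScatFact (suc k) w) count)
mainTheorem9 (suc s) (suc k) w count (suc i) _ _ α β (c , lastα≡c , modusᵢ≡c) sameα inner⊆ _ sameβ
  with X , post , dropᵢ , c∉X , full , arches-post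
         ← arch-head (AllP.drop⁺ i (IsArchFactorisation.all-arch (archFact-sound w))) modusᵢ≡c
  = subst (OneMissing) (sym w'≡)
      (numScatFact-widenArch (suc k) (AllP.take⁺ i all-arch) arches-post c∉X full
        (subst (SameAlph (dropLast α)) innerᵢ≡ sameα) (subst (_⊆ dropLast α) innerᵢ≡ inner⊆)
        rest-notFull sameβ (subst (OneMissing) w≡ count))
  where
  open IsArchFactorisation (archFact-sound w)
  OneMissing : Word (suc s) → Set
  OneMissing v = numScatFact (suc k) v + 1 ≡ suc s ^ suc k
  pre : List (Word (suc s))
  pre = take i (arches w)
  innerᵢ≡ : inner (suc i) w ≡ X
  innerᵢ≡ = inner-≡ i w dropᵢ
  w≡ : w ≡ concat (pre ++ (X ++ [ c ]) ∷ post) ++ rest w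
  w≡ = trans (sym concat-arches-rest) (cong (λ as → concat as ++ rest w)
             (trans (sym (take++drop≡id i (arches w))) (cong (pre ++_) dropᵢ)))
  n≤k : length (arches w) ≤ k
  n≤k = ≤-pred (fewerArches (suc k) all-arch (subst (OneMissing) (sym concat-arches-rest) count))
  w'≡ : replaceArch (suc k) (suc i) w α β ≡ concat (pre ++ (dropLast α ++ [ c ]) ∷ post) ++ β
  w'≡ = trans (replaceArch-≡ k i w {α} {β} n≤k dropᵢ)
        (trans (cong (λ α' → concat pre ++ α' ++ concat post ++ β) (sym (dropLast-++-last α lastα≡c)))
               (sym (concat-++-∷ pre)))
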